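{- Let $d=(d_1,\ldots,d_n)$ be a sequence of positive integers, $\gamma\in[1,n]$, and $G_{d,\gamma}$ the flow network described in the context. Let $(S,T)$ be an $s$-$t$ cut of $G_{d,\gamma}$ with $T\cap Y_D=\emptyset$, and let $S'=S\cup X_S$, $T'=T\setminus X_S$. Then $c(S',T')\le c(S,T)$.
   Context: The network $G_{d,\gamma}$ has node set $\{s,t\}\cup X\cup Y\cup X'_S\cup Y'_S$, where $X=\{x_1,\ldots,x_n\}$, $Y=\{y_1,\ldots,y_n\}$, $X_D=\{x_i:i\in[1,\gamma]\}$, $Y_D=\{y_j:j\in[1,\gamma]\}$, $X_S=\{x_i:i\in[\gamma+1,n]\}$, $Y_S=\{y_j:j\in[\gamma+1,n]\}$, $X'_S=\{x'_i:i\in[\gamma+1,n]\}$, $Y'_S=\{y'_j:j\in[\gamma+1,n]\}$. Its directed edges with capacities are: $(s,x_i)$ cap. $d_i$ and $(y_i,t)$ cap. $d_i$ for $i\in[1,n]$; $(x_i,y_j)$ cap. 1 for $i,j\in[1,\gamma]$, $i\ne j$; $(x_i,y_j)$ cap. 1 for $i\in[1,\gamma]$, $j\in[\gamma+1,n]$; $(x_i,y_j)$ cap. 1 for $i\in[\gamma+1,n]$, $j\in[1,\gamma]$; $(x_i,x'_i)$ cap. $d_i-1$ and $(y'_i,y_i)$ cap. $d_i-1$ for $i\in[\gamma+1,n]$; $(x'_i,y'_j)$ cap. 1 for $i,j\in[\gamma+1,n]$, $i\ne j$. An $s$-$t$ cut is a partition $(S,T)$ of the node set with $s\in S$, $t\in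 T$; its capacity $c(S,T)$ is the total capacity of edges directed from $S$ to $T$. $[a,b]=\{a,\ldots,b\}$. -}

module Defs where

open import Data.Nat using (ℕ; zero; suc; _+_; _∸_; _≤_; _<_; _<?_)
open import Data.Nat.Properties using (≮⇒≥)
open import Data.Fin using (Fin; toℕ; _≟_)
open import Data.List using (List; []; _∷_; _++_; concatMap; allFin; map)
open import Data.Nat.ListAction using (sum)
open import Data.Bool using (Bool; true; false; if_then_else_; _∧_; not)
open import Data.Product using (_×_; _,_)
open import Relation.Nullary using (yes; no)
open import Relation.Binary.PropositionalEquality using (_≡_)

-- Indices are 0-based: x i (i : Fin n) is x_{toℕ i + 1}.
-- Hence x_{i+1} ∈ X_D iff toℕ i < γ, and ∈ X_S iff γ ≤ toℕ i.
data Node (n γ : ℕ) : Set where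
  s t : Node n γ
  x y : Fin n → Node n γ
  x' y' : (i : Fin n) → γ ≤ toℕ i → Node n γ

-- A directed edge with capacity: (tail , head , capacity).
Edge : ℕ → ℕ → Set
Edge n γ = Node n γ × Node n γ × ℕ

xyEdges : ∀ {n} γ → Fin n → Fin n → List (Edge n γ)
xyEdges γ i j with toℕ i <? γ | toℕ j <? γ | i ≟ j
... | yes _ | yes _ | yes _ = []
... | yes _ | yes _ | no _  = (x i , y j , 1) ∷ []
... | yes _ | no _  | _     = (x i , y j , 1) ∷ []
... | no _  | yes _ | _     = (x i , y j , 1) ∷ []
... | no pi | no pj | yes _ = []
... | no pi | no pj | no _  = (x' i (≮⇒≥ pi) , y' j (≮⇒≥ pj) , 1) ∷ []

vertexEdges : ∀ {n} γ → (Fin n → ℕ) → Fin n → List (Edge n γ)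
vertexEdges γ d i with toℕ i <? γ
... | yes _ = (s , x i , d i) ∷ (y i , t , d i) ∷ []
... | no p  = (s , x i , d i) ∷ (y i , t , d i)
              ∷ (x i , x' i (≮⇒≥ p) , d i ∸ 1) ∷ (y' i (≮⇒≥ p) , y i , d i ∸ 1) ∷ []

edges : ∀ n γ → (Fin n → ℕ) → List (Edge n γ)
edges n γ d = concatMap (vertexEdges γ d) (allFin n)
           ++ concatMap (λ i → concatMap (xyEdges γ i) (allFin n)) (allFin n)

-- A cut is given by its side function: inS v = true iff v ∈ S (so T is the complement).
record Cut (n γ : ℕ) : Set where
  field
    inS  : Node n γ → Bool
    s∈S  : inS s ≡ true
    t∈T  : inS t ≡ false

capacity : ∀ n γ → (Fin n → ℕ) → (Node n γ → Bool) → ℕ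
capacity n γ d inS = sum (map (λ { (u , v , c) → if inS u ∧ not (inS v) then c else 0 }) (edges n γ d))

moveXS : ∀ {n γ} → (Node n γ → Bool) → Node n γ → Bool
moveXS {γ = γ} inS (x i) with toℕ i <? γ
... | yes _ = inS (x i)
... | no _  = true
moveXS inS v = inS v

{-# OPTIONS --safe #-}
-- Adding x_i ∈ X_S to S changes only the cut status of edges at x_i. The edge (s, x_i) of
-- capacity d_i leaves the cut; of the edges out of x_i, those into Y_D stay uncut because
-- Y_D ⊆ S, and only (x_i, x'_i), of capacity d_i - 1, can enter it. Hence the capacity does
-- not increase.
module Submission where

open import Defs
open import Data.Nat using (ℕ; _≤_; _<_; _+_; _∸_; z≤n; _<?_)
open import Data.Nat.Properties
  using (≤-refl; +-mono-≤; +-monoˡ-≤; m∸n≤m; ≤-trans; ≮⇒≥; +-commutativeSemigroup; module ≤-Reasoning)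
open import Data.Fin using (Fin; toℕ; _≟_)
open import Data.Bool using (Bool; true; false; if_then_else_; _∧_; not)
open import Data.List using (List; []; _∷_; _++_; concatMap; allFin; map)
open import Data.Nat.ListAction using (sum)
open import Data.Nat.ListAction.Properties using (sum-++)
open import Data.List.Properties using (map-++; map-cong)
open import Data.Product using (_×_; _,_)
open import Relation.Nullary using (yes; no; ¬_; contradiction)
open import Relation.Binary.PropositionalEquality using (_≡_; refl; sym; trans; cong; subst₂)
open import Algebra.Properties.CommutativeSemigroup +-commutativeSemigroup using (x∙yz≈y∙xz)

module _ {V : Set} where

  crossing : (V → Bool) → V × V × ℕ → ℕ
  crossing inS (u , v , c) = if inS u ∧ not (inS v) then c else 0

  cutWeight : (V → Bool) → List (V × V × ℕ) → ℕ
  cutWeight inS es = sum (map (crossing inS) es)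

  cutWeight-++ : ∀ inS es fs → cutWeight inS (es ++ fs) ≡ cutWeight inS es + cutWeight inS fs
  cutWeight-++ inS es fs =
    trans (cong sum (map-++ (crossing inS) es fs)) (sum-++ (map (crossing inS) es) (map (crossing inS) fs))

  cutWeight-++-mono : ∀ (inS′ inS : V → Bool) {es fs} →
    cutWeight inS′ es ≤ cutWeight inS es → cutWeight inS′ fs ≤ cutWeight inS fs →
    cutWeight inS′ (es ++ fs) ≤ cutWeight inS (es ++ fs)
  cutWeight-++-mono inS′ inS {es} {fs} es-mono fs-mono
    rewrite cutWeight-++ inS′ es fs | cutWeight-++ inS es fs = +-mono-≤ es-mono fs-mono

  cutWeight-concatMap-mono : ∀ {A : Set} (inS′ inS : V → Bool) (g : A → List (V × V × ℕ)) →
    (∀ a → cutWeight inS′ (g a) ≤ cutWeight inS (g a)) →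
    ∀ as → cutWeight inS′ (concatMap g as) ≤ cutWeight inS (concatMap g as)
  cutWeight-concatMap-mono inS′ inS g mono [] = z≤n
  cutWeight-concatMap-mono inS′ inS g mono (a ∷ as) =
    cutWeight-++-mono inS′ inS {g a} {concatMap g as} (mono a) (cutWeight-concatMap-mono inS′ inS g mono as)

if-≤ : ∀ b m → (if b then m else 0) ≤ m
if-≤ true  m = ≤-refl
if-≤ false m = z≤n

module _ {n γ : ℕ} where

  capacity≡cutWeight : ∀ d (inS : Node n γ → Bool) → capacity n γ d inS ≡ cutWeight inS (edges n γ d)
  capacity≡cutWeight d inS = cong sum (map-cong (λ { (u , v , c) → refl }) (edges n γ d))

  moveXS-x∈X_D : ∀ (inS : Node n γ → Bool) {i} → toℕ i < γ → moveXS inS (x i) ≡ inS (x i)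
  moveXS-x∈X_D inS {i} i<γ with toℕ i <? γ
  ... | yes _   = refl
  ... | no i≮γ = contradiction i<γ i≮γ

  moveXS-x∈X_S : ∀ (inS : Node n γ → Bool) {i} → ¬ toℕ i < γ → moveXS inS (x i) ≡ true
  moveXS-x∈X_S inS {i} i≮γ with toℕ i <? γ
  ... | yes i<γ = contradiction i<γ i≮γ
  ... | no _    = refl

  vertexEdges-moveXS-≤ : ∀ d (inS : Node n γ → Bool) → inS s ≡ true → ∀ i →
    cutWeight (moveXS inS) (vertexEdges γ d i) ≤ cutWeight inS (vertexEdges γ d i)
  vertexEdges-moveXS-≤ d inS s∈S i with toℕ i <? γ
  ... | yes i<γ rewrite moveXS-x∈X_D inS i<γ = ≤-refl
  ... | no i≮γ rewrite moveXS-x∈X_S inS i≮γ | s∈S with inS (x i)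
  ...   | true  = ≤-refl
  ...   | false = begin
      kept + (gained + kept′)  ≡⟨ x∙yz≈y∙xz kept gained kept′ ⟩
      gained + (kept + kept′)  ≤⟨ +-monoˡ-≤ (kept + kept′) (≤-trans (if-≤ (not (inS x′)) (d i ∸ 1)) (m∸n≤m (d i) 1)) ⟩
      d i + (kept + kept′) ∎
    where
    open ≤-Reasoning
    x′ : Node n γ
    x′ = x' i (≮⇒≥ i≮γ)
    kept gained kept′ : ℕ
    kept   = crossing inS (y i , t , d i)
    gained = if not (inS x′) then d i ∸ 1 else 0
    kept′  = crossing inS (y' i (≮⇒≥ i≮γ) , y i , d i ∸ 1) + 0

  xyEdges-moveXS-≤ : ∀ (inS : Node n γ → Bool) → (∀ j → toℕ j < γ → inS (y j) ≡ true) → ∀ i j →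
    cutWeight (moveXS inS) (xyEdges γ i j) ≤ cutWeight inS (xyEdges γ i j)
  xyEdges-moveXS-≤ inS Y_D⊆S i j with toℕ i <? γ | toℕ j <? γ | i ≟ j
  ... | yes _   | yes _   | yes _ = ≤-refl
  ... | yes i<γ | yes _   | no _  rewrite moveXS-x∈X_D inS i<γ = ≤-refl
  ... | yes i<γ | no _    | _     rewrite moveXS-x∈X_D inS i<γ = ≤-refl
  ... | no i≮γ  | yes j<γ | _     rewrite moveXS-x∈X_S inS i≮γ | Y_D⊆S j j<γ = z≤n
  ... | no _    | no _    | yes _ = ≤-refl
  ... | no _    | no _    | no _  = ≤-refl

  edges-moveXS-≤ : ∀ d (inS : Node n γ → Bool) → inS s ≡ true → (∀ j → toℕ j < γ → inS (y j) ≡ true) →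
    cutWeight (moveXS inS) (edges n γ d) ≤ cutWeight inS (edges n γ d)
  edges-moveXS-≤ d inS s∈S Y_D⊆S =
    cutWeight-++-mono (moveXS inS) inS {concatMap (vertexEdges γ d) (allFin n)}
      (cutWeight-concatMap-mono (moveXS inS) inS (vertexEdges γ d) (vertexEdges-moveXS-≤ d inS s∈S) (allFin n))
      (cutWeight-concatMap-mono (moveXS inS) inS (λ i → concatMap (xyEdges γ i) (allFin n))
        (λ i → cutWeight-concatMap-mono (moveXS inS) inS (xyEdges γ i) (xyEdges-moveXS-≤ inS Y_D⊆S i) (allFin n))
        (allFin n))

lemma6 : (n γ : ℕ) (d : Fin n → ℕ) → (∀ i → 1 ≤ d i) → 1 ≤ γ → γ ≤ n →
         (C : Cut n γ) →
         (∀ (j : Fin n) → toℕ j < γ → Cut.inS C (y j) ≡ true) →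
         capacity n γ d (moveXS (Cut.inS C)) ≤ capacity n γ d (Cut.inS C)
lemma6 n γ d _ _ _ C Y_D⊆S =
  subst₂ _≤_ (sym (capacity≡cutWeight d (moveXS S))) (sym (capacity≡cutWeight d S))
    (edges-moveXS-≤ d S (Cut.s∈S C) Y_D⊆S)
  where
  S : Node n γ → Bool
  S = Cut.inS C
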